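{- Let $P\in\mathcal{C}(G_n)$. For all $S\in\mathrm{char}(\mathrm{weave}_k^1(P))$ with $S\neq Q_{n+1}$, $k\notin S$.
   Context: Let $Q_n=\{1,\dots,n\}$ be a set of $n$ yes/no questions; an outcome on $S\subseteq Q_n$ is an element of $\{0,1\}^{|S|}$, and $X_S$ is the set of outcomes on $S$. A preference matrix on $Q_n$ is a $2^n\times n$ 0-1 matrix whose rows are the $2^n$ outcomes, each exactly once, ordered from most to least preferred. For a nonempty proper $S\subset Q_n$ and outcome $x$ on $Q_n-S$, $P^{[Q_n-S,x]}$ is the submatrix formed by the columns in $S$ and rows with outcome $x$ on $Q_n-S$ (in order); $S$ is separable with respect to $P$ if $P^{[Q_n-S,x]}=P^{[Q_n-S,y]}$ for all $x,y\in X_{Q_n-S}$; $\emptyset$ and $Q_n$ are always separable. The character $\mathrm{char}(P)$ is the set of all subsets of $Q_n$ separable with respect to $P$. $\mathcal{C}(G_n)$ is the set of preference matrices generated by Hamiltonian paths in the $n$-dimensional hypercube graph $G_n$ with Gray code labeling, i.e. preference matrices in which consecutive rows differ in exactly one entry. For $A\in\mathcal{C}(G_n)$ and $k\in\{1,\dots,n+1\}$, $\mathrm{weave}_k^1(A)$ is the $2^{n+1}\times(n+1)$ matrix (a preference matrix on $Q_{n+1}$) obtained by duplicating each row of $A$ (rows $2i-1$ and $2i$ both equal row $i$ of $A$) and inserting a new column in position $k$ (shifting later columns right) whose $i$-th entry is $1$ if $i\equiv 0,1 \pmod 4$ and $0$ if $i\equiv 2,3\pmod 4$. -}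

module Defs where

open import Data.Bool using (Bool; true; false; not; if_then_else_)
open import Data.Nat using (ℕ; zero; suc; _+_; _%_; _^_)
open import Data.Fin using (Fin)
open import Data.Vec using (Vec; []; _∷_; insertAt)
open import Data.List using (List; []; _∷_; length; filter; map)
open import Data.List.Membership.Propositional using (_∈_)
open import Data.List.Relation.Unary.Unique.Propositional using (Unique)
open import Data.Fin.Subset using (Subset)
import Data.Fin.Subset as Sub
open import Data.Product using (_×_)
open import Data.Sum using (_⊎_)
open import Relation.Binary.PropositionalEquality using (_≡_)
open import Relation.Nullary using (Dec; yes; no)
open import Data.Bool.Properties using () renaming (_≟_ to _≟B_)

-- An outcome on Q_n : a vector of n booleans (true = yes = 1).
Outcome : ℕ → Set
Outcome n = Vec Bool n

-- A matrix with n columns, given as its list of rows, top (most preferred) first.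
Rows : ℕ → Set
Rows n = List (Outcome n)

IsPrefMatrix : (n : ℕ) → Rows n → Set
IsPrefMatrix n rs = (length rs ≡ 2 ^ n) × Unique rs × (∀ (x : Outcome n) → x ∈ rs)

hamming : ∀ {n} → Outcome n → Outcome n → ℕ
hamming [] [] = 0
hamming (a ∷ as) (b ∷ bs) with a ≟B b
... | yes _ = hamming as bs
... | no _ = suc (hamming as bs)

ConsecutiveOneApart : ∀ {n} → Rows n → Set
ConsecutiveOneApart [] = Data.Unit.⊤
  where import Data.Unit
ConsecutiveOneApart (r ∷ []) = Data.Unit.⊤
  where import Data.Unit
ConsecutiveOneApart (r ∷ s ∷ rs) = (hamming r s ≡ 1) × ConsecutiveOneApart (s ∷ rs)

-- P ∈ C(G_n): a preference matrix generated by a Hamiltonian path of the hypercube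
-- (Gray code labeling), i.e. consecutive rows differ in exactly one entry.
InCGn : (n : ℕ) → Rows n → Set
InCGn n P = IsPrefMatrix n P × ConsecutiveOneApart P

agreeOff : ∀ {n} → Subset n → Outcome n → Outcome n → Bool
agreeOff [] [] [] = true
agreeOff (s ∷ S) (a ∷ as) (b ∷ bs) with s
... | true = agreeOff S as bs
... | false with a ≟B b
... | yes _ = agreeOff S as bs
... | no _ = false

project : ∀ {n} → Subset n → Outcome n → List Bool
project [] [] = []
project (true ∷ S) (a ∷ as) = a ∷ project S as
project (false ∷ S) (a ∷ as) = project S as

-- P^{[Q_n - S, x]} : rows of P whose outcome on Q_n - S equals that of x
-- (x a full outcome; only its restriction to Q_n - S matters), restricted to columns in S.
subMatrix : ∀ {n} → Rows n → Subset n → Outcome n → List (List Bool)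
subMatrix P S x = map (project S) (filter (λ r → agreeOff S x r Data.Bool.≟ true) P)
  where import Data.Bool

Separable : ∀ {n} → Rows n → Subset n → Set
Separable P S = (S ≡ Sub.⊥) ⊎ (S ≡ Sub.⊤) ⊎
  (∀ (x y : Outcome _) → subMatrix P S x ≡ subMatrix P S y)

InChar : ∀ {n} → Subset n → Rows n → Set
InChar S P = Separable P S

dup : ∀ {A : Set} → List A → List A
dup [] = []
dup (a ∷ as) = a ∷ a ∷ dup as

-- new column entry for (1-indexed) row i : 1 iff i ≡ 0,1 (mod 4)
weaveBit : ℕ → Bool
weaveBit i with i % 4
... | 0 = true
... | 1 = true
... | _ = false

insertCol : ∀ {n} → Fin (suc n) → ℕ → Rows n → Rows (suc n)
insertCol k i [] = []
insertCol k i (r ∷ rs) = insertAt r k (weaveBit i) ∷ insertCol k (suc i) rs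

-- weave_k^1(A); column position k ∈ {1,…,n+1} is represented by Fin (suc n) (0-indexed).
weave1 : ∀ {n} → Fin (suc n) → Rows n → Rows (suc n)
weave1 k A = insertCol k 1 (dup A)

-- Let W = weave₁ᵏ(P) and w₁, w₂ its first two rows: the two copies of the first row of P, which
-- differ only in column k, so they agree off S when k ∈ S. W is a Gray sequence through every
-- outcome and S ≠ Q, so walking down W we leave the class of rows agreeing with w₁ off S at some
-- step z → y. The coordinate flipped there lies outside S, so z and y have the same S-part.
-- All rows above y lie in w₁'s class, so y heads the block P^[Q−S,y] just as w₁ heads its own;
-- separability makes the S-parts of w₁ and y, hence of w₁ and z, equal. Then z = w₁, although z
-- lies strictly below w₁ and every outcome occurs only once.
module Submission where

open import Defs
open import Data.Bool using (Bool; true; false; not; _≟_)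
open import Data.Bool.Properties using (¬-not)
open import Function using (_∘_)
open import Data.Fin using (Fin; zero; suc)
open import Data.Fin.Subset using (Subset; _∈_; _∉_; ⊤)
open import Data.Fin.Subset.Properties using (∉⊥)
open import Data.List using (List; []; _∷_; _++_; _∷ʳ_; [_]; filter; map)
open import Data.List.Properties using (++-assoc; ∷-injectiveˡ; ∷-injectiveʳ; filter-++; filter-none; filter-accept)
import Data.List.Membership.Propositional as List
open import Data.List.Membership.Propositional.Properties using (∈-++⁺ʳ)
open import Data.List.Relation.Unary.All as All using (All; []; _∷_)
open import Data.List.Relation.Unary.All.Properties using (∷ʳ⁺)
open import Data.List.Relation.Unary.Any as Any using (Any; here; there)
open import Data.List.Relation.Unary.Unique.Propositional using (Unique)
open import Data.List.Relation.Unary.Unique.Propositional.Properties using (Unique[x∷xs]⇒x∉xs)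
open import Data.Nat using (ℕ; suc; _+_; _%_)
open import Data.Nat.Properties using (suc-injective)
open import Data.Product using (∃; ∃₂; _×_; _,_)
open import Data.Sum using (inj₁; inj₂)
open import Data.Unit using (tt)
open import Data.Vec using ([]; _∷_; _[_]=_; here; there; insertAt; removeAt; updateAt; lookup; replicate)
open import Data.Vec.Properties using (insertAt-lookup; removeAt-insertAt; insertAt-removeAt)
open import Relation.Binary.PropositionalEquality using (_≡_; _≢_; refl; sym; trans; cong; cong₂; subst; module ≡-Reasoning)
open import Relation.Nullary using (¬_; yes; no; contradiction)
open import Relation.Unary using (Pred; Decidable; ∁)

hamming-refl : ∀ {n} (u : Outcome n) → hamming u u ≡ 0
hamming-refl [] = refl
hamming-refl (true ∷ u) = hamming-refl u
hamming-refl (false ∷ u) = hamming-refl u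

hamming≡0⇒≡ : ∀ {n} (u v : Outcome n) → hamming u v ≡ 0 → u ≡ v
hamming≡0⇒≡ [] [] _ = refl
hamming≡0⇒≡ (true ∷ u) (true ∷ v) h = cong (true ∷_) (hamming≡0⇒≡ u v h)
hamming≡0⇒≡ (false ∷ u) (false ∷ v) h = cong (false ∷_) (hamming≡0⇒≡ u v h)

hamming-insertAt : ∀ {n} (u v : Outcome n) (k : Fin (suc n)) {a b : Bool} → a ≡ b →
                   hamming (insertAt u k a) (insertAt v k b) ≡ hamming u v
hamming-insertAt u v zero {true} refl = refl
hamming-insertAt u v zero {false} refl = refl
hamming-insertAt (true ∷ u) (true ∷ v) (suc k) a≡b = hamming-insertAt u v k a≡b
hamming-insertAt (true ∷ u) (false ∷ v) (suc k) a≡b = cong suc (hamming-insertAt u v k a≡b)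
hamming-insertAt (false ∷ u) (true ∷ v) (suc k) a≡b = cong suc (hamming-insertAt u v k a≡b)
hamming-insertAt (false ∷ u) (false ∷ v) (suc k) a≡b = hamming-insertAt u v k a≡b

hamming-insertAt-not : ∀ {n} (u : Outcome n) (k : Fin (suc n)) {a b : Bool} → b ≡ not a →
                       hamming (insertAt u k a) (insertAt u k b) ≡ 1
hamming-insertAt-not u zero {true} refl = cong suc (hamming-refl u)
hamming-insertAt-not u zero {false} refl = cong suc (hamming-refl u)
hamming-insertAt-not (true ∷ u) (suc k) b≡¬a = hamming-insertAt-not u k b≡¬a
hamming-insertAt-not (false ∷ u) (suc k) b≡¬a = hamming-insertAt-not u k b≡¬a

ConsecutiveOneApart-++⁻ : ∀ {n} (pre : Rows n) {z y : Outcome n} {post : Rows n} →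
                          ConsecutiveOneApart (pre ++ z ∷ y ∷ post) → hamming z y ≡ 1
ConsecutiveOneApart-++⁻ [] (z-y , _) = z-y
ConsecutiveOneApart-++⁻ (r ∷ []) {z} (_ , gray) = ConsecutiveOneApart-++⁻ [] {z} gray
ConsecutiveOneApart-++⁻ (r ∷ s ∷ pre) {z} (_ , gray) = ConsecutiveOneApart-++⁻ (s ∷ pre) {z} gray

agreeOff-refl : ∀ {n} (S : Subset n) (u : Outcome n) → agreeOff S u u ≡ true
agreeOff-refl [] [] = refl
agreeOff-refl (true ∷ S) (_ ∷ u) = agreeOff-refl S u
agreeOff-refl (false ∷ S) (true ∷ u) = agreeOff-refl S u
agreeOff-refl (false ∷ S) (false ∷ u) = agreeOff-refl S u

agreeOff-sym : ∀ {n} (S : Subset n) (u v : Outcome n) → agreeOff S u v ≡ agreeOff S v u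
agreeOff-sym [] [] [] = refl
agreeOff-sym (true ∷ S) (_ ∷ u) (_ ∷ v) = agreeOff-sym S u v
agreeOff-sym (false ∷ S) (true ∷ u) (true ∷ v) = agreeOff-sym S u v
agreeOff-sym (false ∷ S) (false ∷ u) (false ∷ v) = agreeOff-sym S u v
agreeOff-sym (false ∷ S) (true ∷ u) (false ∷ v) = refl
agreeOff-sym (false ∷ S) (false ∷ u) (true ∷ v) = refl

agreeOff-trans : ∀ {n} (S : Subset n) (u v w : Outcome n) →
                 agreeOff S u v ≡ true → agreeOff S v w ≡ true → agreeOff S u w ≡ true
agreeOff-trans [] [] [] [] _ _ = refl
agreeOff-trans (true ∷ S) (_ ∷ u) (_ ∷ v) (_ ∷ w) = agreeOff-trans S u v w
agreeOff-trans (false ∷ S) (true ∷ u) (true ∷ v) (true ∷ w) = agreeOff-trans S u v w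
agreeOff-trans (false ∷ S) (false ∷ u) (false ∷ v) (false ∷ w) = agreeOff-trans S u v w
agreeOff-trans (false ∷ S) (true ∷ u) (false ∷ v) _ ()
agreeOff-trans (false ∷ S) (false ∷ u) (true ∷ v) _ ()
agreeOff-trans (false ∷ S) (true ∷ u) (true ∷ v) (false ∷ w) _ ()
agreeOff-trans (false ∷ S) (false ∷ u) (false ∷ v) (true ∷ w) _ ()

agreeOff-disagreeˡ : ∀ {n} (S : Subset n) {u v w : Outcome n} →
                     agreeOff S u v ≡ true → agreeOff S u w ≢ true → agreeOff S w v ≢ true
agreeOff-disagreeˡ S {u} {v} {w} u~v u≁w w~v =
  u≁w (agreeOff-trans S u v w u~v (trans (agreeOff-sym S v w) w~v))

≡-from-agreeOff-project : ∀ {n} (S : Subset n) {u v : Outcome n} →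
                          agreeOff S u v ≡ true → project S u ≡ project S v → u ≡ v
≡-from-agreeOff-project [] {[]} {[]} _ _ = refl
≡-from-agreeOff-project (true ∷ S) {a ∷ u} {b ∷ v} u~v pu≡pv =
  cong₂ _∷_ (∷-injectiveˡ pu≡pv) (≡-from-agreeOff-project S u~v (∷-injectiveʳ pu≡pv))
≡-from-agreeOff-project (false ∷ S) {true ∷ u} {true ∷ v} u~v pu≡pv =
  cong (true ∷_) (≡-from-agreeOff-project S u~v pu≡pv)
≡-from-agreeOff-project (false ∷ S) {false ∷ u} {false ∷ v} u~v pu≡pv =
  cong (false ∷_) (≡-from-agreeOff-project S u~v pu≡pv)
≡-from-agreeOff-project (false ∷ S) {true ∷ u} {false ∷ v} ()
≡-from-agreeOff-project (false ∷ S) {false ∷ u} {true ∷ v} ()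

hamming≡1-off⇒project-≡ : ∀ {n} (S : Subset n) {u v : Outcome n} →
                          hamming u v ≡ 1 → agreeOff S u v ≢ true → project S u ≡ project S v
hamming≡1-off⇒project-≡ [] {[]} {[]} ()
hamming≡1-off⇒project-≡ (true ∷ S) {true ∷ u} {true ∷ v} h u≁v =
  cong (true ∷_) (hamming≡1-off⇒project-≡ S h u≁v)
hamming≡1-off⇒project-≡ (true ∷ S) {false ∷ u} {false ∷ v} h u≁v =
  cong (false ∷_) (hamming≡1-off⇒project-≡ S h u≁v)
hamming≡1-off⇒project-≡ (false ∷ S) {true ∷ u} {true ∷ v} h u≁v = hamming≡1-off⇒project-≡ S h u≁v
hamming≡1-off⇒project-≡ (false ∷ S) {false ∷ u} {false ∷ v} h u≁v = hamming≡1-off⇒project-≡ S h u≁v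
hamming≡1-off⇒project-≡ (true ∷ S) {true ∷ u} {false ∷ v} h u≁v
  with refl ← hamming≡0⇒≡ u v (suc-injective h) = contradiction (agreeOff-refl S u) u≁v
hamming≡1-off⇒project-≡ (true ∷ S) {false ∷ u} {true ∷ v} h u≁v
  with refl ← hamming≡0⇒≡ u v (suc-injective h) = contradiction (agreeOff-refl S u) u≁v
hamming≡1-off⇒project-≡ (false ∷ S) {true ∷ u} {false ∷ v} h _ =
  cong (project S) (hamming≡0⇒≡ u v (suc-injective h))
hamming≡1-off⇒project-≡ (false ∷ S) {false ∷ u} {true ∷ v} h _ =
  cong (project S) (hamming≡0⇒≡ u v (suc-injective h))

module _ {a p} {A : Set a} {P : Pred A p} (P? : Decidable P) where

  split-at-exit : ∀ {x xs} → P x → Any (∁ P) xs →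
                  ∃₂ λ pre post → ∃₂ λ z y →
                    x ∷ xs ≡ pre ++ z ∷ y ∷ post × All P pre × P z × ¬ P y
  split-at-exit {x} {y ∷ xs} px ∁Pxs with P? y | ∁Pxs
  ... | no ¬py | _ = [] , xs , x , y , refl , [] , px , ¬py
  ... | yes py | here ¬py = contradiction py ¬py
  ... | yes py | there ∁Pxs′ with split-at-exit py ∁Pxs′
  ...   | pre , post , z , y′ , split , Ppre , pz , ¬py′ =
          x ∷ pre , post , z , y′ , cong (x ∷_) split , px ∷ Ppre , pz , ¬py′

subMatrix-++-∷ : ∀ {n} (S : Subset n) (pre post : Rows n) (y : Outcome n) →
                 All (λ r → agreeOff S y r ≢ true) pre →
                 subMatrix (pre ++ y ∷ post) S y ≡ project S y ∷ subMatrix post S y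
subMatrix-++-∷ S pre post y y≁pre = cong (map (project S)) (begin
  filter agrees (pre ++ y ∷ post)               ≡⟨ filter-++ agrees pre (y ∷ post) ⟩
  filter agrees pre ++ filter agrees (y ∷ post) ≡⟨ cong (_++ _) (filter-none agrees y≁pre) ⟩
  filter agrees (y ∷ post)                      ≡⟨ filter-accept agrees (agreeOff-refl S y) ⟩
  y ∷ filter agrees post                        ∎)
  where
  open ≡-Reasoning
  agrees : Decidable (λ r → agreeOff S y r ≡ true)
  agrees r = agreeOff S y r ≟ true

gray-subMatrix-not-constant :
  ∀ {n} (S : Subset n) {w₁ w₂ : Outcome n} {rest : Rows n} → let W = w₁ ∷ w₂ ∷ rest in
  ConsecutiveOneApart W → w₁ List.∉ w₂ ∷ rest →
  agreeOff S w₁ w₂ ≡ true → Any (λ r → agreeOff S w₁ r ≢ true) (w₂ ∷ rest) →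
  ¬ (∀ x y → subMatrix W S x ≡ subMatrix W S y)
gray-subMatrix-not-constant S {w₁} {w₂} {rest} gray w₁∉ w₁~w₂ w₁≁some constant
  with split-at-exit (λ r → agreeOff S w₁ r ≟ true) w₁~w₂ (Any.tail (λ w₁≁w₂ → w₁≁w₂ w₁~w₂) w₁≁some)
... | pre , post , z , y , split , w₁~pre , w₁~z , w₁≁y =
  w₁∉ (subst (List._∈ w₂ ∷ rest) (sym w₁≡z) z∈)
  where
  open ≡-Reasoning
  W = w₁ ∷ w₂ ∷ rest
  z∈ : z List.∈ w₂ ∷ rest
  z∈ = subst (z List.∈_) (sym split) (∈-++⁺ʳ pre (here refl))
  W-at-y : W ≡ ((w₁ ∷ pre) ∷ʳ z) ++ y ∷ post
  W-at-y = cong (w₁ ∷_) (trans split (sym (++-assoc pre [ z ] (y ∷ post))))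
  y≁before : All (λ r → agreeOff S y r ≢ true) ((w₁ ∷ pre) ∷ʳ z)
  y≁before = All.map (λ w₁~r → agreeOff-disagreeˡ S w₁~r w₁≁y)
                     (∷ʳ⁺ (agreeOff-refl S w₁ ∷ w₁~pre) w₁~z)
  project-w₁≡y : project S w₁ ≡ project S y
  project-w₁≡y = ∷-injectiveˡ (begin
    project S w₁ ∷ subMatrix (w₂ ∷ rest) S w₁     ≡⟨ subMatrix-++-∷ S [] (w₂ ∷ rest) w₁ [] ⟨
    subMatrix W S w₁                              ≡⟨ constant w₁ y ⟩
    subMatrix W S y                               ≡⟨ cong (λ L → subMatrix L S y) W-at-y ⟩
    subMatrix (((w₁ ∷ pre) ∷ʳ z) ++ y ∷ post) S y ≡⟨ subMatrix-++-∷ S _ post y y≁before ⟩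
    project S y ∷ subMatrix post S y              ∎)
  project-z≡y : project S z ≡ project S y
  project-z≡y = hamming≡1-off⇒project-≡ S
    (ConsecutiveOneApart-++⁻ (w₁ ∷ pre) (subst ConsecutiveOneApart (cong (w₁ ∷_) split) gray))
    (agreeOff-disagreeˡ S w₁~z w₁≁y ∘ trans (agreeOff-sym S y z))
  w₁≡z : w₁ ≡ z
  w₁≡z = ≡-from-agreeOff-project S w₁~z (trans project-w₁≡y (sym project-z≡y))

-- (4 + i) % 4 reduces to i % 4 by evaluation, so matching on i % 4 settles both sides.
weaveBit-+4 : ∀ i → weaveBit (4 + i) ≡ weaveBit i
weaveBit-+4 i with i % 4
... | 0 = refl
... | 1 = refl
... | suc (suc _) = refl

weaveBit-+2 : ∀ i → weaveBit (2 + i) ≡ not (weaveBit i)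
weaveBit-+2 0 = refl
weaveBit-+2 1 = refl
weaveBit-+2 2 = refl
weaveBit-+2 3 = refl
weaveBit-+2 (suc (suc (suc (suc i)))) = begin
  weaveBit (4 + (2 + i))  ≡⟨ weaveBit-+4 (2 + i) ⟩
  weaveBit (2 + i)        ≡⟨ weaveBit-+2 i ⟩
  not (weaveBit i)        ≡⟨ cong not (weaveBit-+4 i) ⟨
  not (weaveBit (4 + i))  ∎
  where open ≡-Reasoning

-- Holds at the odd indices, where rows i and i + 1 of weave₁ᵏ(P) are the two copies of one row.
WeaveFlipsAt : ℕ → Set
WeaveFlipsAt i = weaveBit (suc i) ≡ not (weaveBit i)

weaveBit-steady : ∀ {i} → WeaveFlipsAt i → weaveBit (2 + i) ≡ weaveBit (suc i)
weaveBit-steady {i} flips = trans (weaveBit-+2 i) (sym flips)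

WeaveFlipsAt-+2 : ∀ {i} → WeaveFlipsAt i → WeaveFlipsAt (2 + i)
WeaveFlipsAt-+2 {i} flips = trans (weaveBit-+2 (suc i)) (cong not (sym (weaveBit-steady {i} flips)))

insertCol-dup-gray : ∀ {n} (k : Fin (suc n)) {i} → WeaveFlipsAt i → {P : Rows n} →
                     ConsecutiveOneApart P → ConsecutiveOneApart (insertCol k i (dup P))
insertCol-dup-gray k flips {[]} _ = tt
insertCol-dup-gray k flips {p ∷ []} _ = hamming-insertAt-not p k flips , tt
insertCol-dup-gray k {i} flips {p ∷ q ∷ P} (p-q , gray) =
  hamming-insertAt-not p k flips ,
  trans (hamming-insertAt p q k (sym (weaveBit-steady {i} flips))) p-q ,
  insertCol-dup-gray k (WeaveFlipsAt-+2 {i} flips) gray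

∈-insertCol-dup⁺ : ∀ {n} (k : Fin (suc n)) {i} → WeaveFlipsAt i → {P : Rows n} {r : Outcome n} →
                   r List.∈ P → ∀ b → insertAt r k b List.∈ insertCol k i (dup P)
∈-insertCol-dup⁺ k {i} flips (here refl) b with b ≟ weaveBit i
... | yes refl = here refl
... | no b≢ = there (here (cong (insertAt _ k) (trans (¬-not b≢) (sym flips))))
∈-insertCol-dup⁺ k {i} flips (there r∈P) b =
  there (there (∈-insertCol-dup⁺ k (WeaveFlipsAt-+2 {i} flips) r∈P b))

∈-insertCol⁻ : ∀ {n} (k : Fin (suc n)) i {L : Rows n} {x : Outcome (suc n)} →
               x List.∈ insertCol k i L → removeAt x k List.∈ L
∈-insertCol⁻ k i {r ∷ L} (here refl) = here (removeAt-insertAt r k (weaveBit i))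
∈-insertCol⁻ k i {r ∷ L} (there x∈) = there (∈-insertCol⁻ k (suc i) x∈)

∈-dup⁻ : ∀ {A : Set} {xs : List A} {x : A} → x List.∈ dup xs → x List.∈ xs
∈-dup⁻ {xs = _ ∷ _} (here x≡) = here x≡
∈-dup⁻ {xs = _ ∷ _} (there (here x≡)) = here x≡
∈-dup⁻ {xs = _ ∷ _} (there (there x∈)) = there (∈-dup⁻ x∈)

weave1-complete : ∀ {n} (k : Fin (suc n)) {P : Rows n} →
                  (∀ x → x List.∈ P) → ∀ v → v List.∈ weave1 k P
weave1-complete k {P} complete v = subst (List._∈ weave1 k P) (insertAt-removeAt v k)
  (∈-insertCol-dup⁺ k refl (complete (removeAt v k)) (lookup v k))

weave1-head-∉ : ∀ {n} (k : Fin (suc n)) {p : Outcome n} {P : Rows n} → Unique (p ∷ P) →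
                insertAt p k true List.∉ insertAt p k false ∷ insertCol k 3 (dup P)
weave1-head-∉ k {p} _ (here eq)
  with () ← trans (sym (insertAt-lookup p k true))
                  (trans (cong (λ v → lookup v k) eq) (insertAt-lookup p k false))
weave1-head-∉ k {p} unique (there x∈) = Unique[x∷xs]⇒x∉xs unique
  (∈-dup⁻ (subst (List._∈ dup _) (removeAt-insertAt p k true) (∈-insertCol⁻ k 3 x∈)))

agreeOff-insertAt : ∀ {n} {S : Subset (suc n)} {k : Fin (suc n)} → k ∈ S →
                    (u : Outcome n) (a b : Bool) → agreeOff S (insertAt u k a) (insertAt u k b) ≡ true
agreeOff-insertAt {S = _ ∷ S} here u a b = agreeOff-refl S u
agreeOff-insertAt {S = true ∷ _} (there k∈S) (_ ∷ u) a b = agreeOff-insertAt k∈S u a b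
agreeOff-insertAt {S = false ∷ _} (there k∈S) (true ∷ u) a b = agreeOff-insertAt k∈S u a b
agreeOff-insertAt {S = false ∷ _} (there k∈S) (false ∷ u) a b = agreeOff-insertAt k∈S u a b

∃-outside : ∀ {n} {S : Subset n} → S ≢ ⊤ → ∃ λ j → S [ j ]= false
∃-outside {S = []} S≢⊤ = contradiction refl S≢⊤
∃-outside {S = false ∷ _} _ = zero , here
∃-outside {S = true ∷ _} S≢⊤ with j , j∉S ← ∃-outside (S≢⊤ ∘ cong (true ∷_)) = suc j , there j∉S

agreeOff-updateAt-not : ∀ {n} {S : Subset n} {j : Fin n} → S [ j ]= false →
                        (u : Outcome n) → agreeOff S u (updateAt u j not) ≢ true
agreeOff-updateAt-not here (true ∷ u) ()
agreeOff-updateAt-not here (false ∷ u) ()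
agreeOff-updateAt-not {S = true ∷ _} (there j∉S) (_ ∷ u) = agreeOff-updateAt-not j∉S u
agreeOff-updateAt-not {S = false ∷ _} (there j∉S) (true ∷ u) = agreeOff-updateAt-not j∉S u
agreeOff-updateAt-not {S = false ∷ _} (there j∉S) (false ∷ u) = agreeOff-updateAt-not j∉S u

complete⇒disagreeing : ∀ {n} {S : Subset n} → S ≢ ⊤ → {u : Outcome n} {L : Rows n} →
                       (∀ v → v List.∈ u ∷ L) → Any (λ r → agreeOff S u r ≢ true) L
complete⇒disagreeing {S = S} S≢⊤ {u} complete
  with j , j∉S ← ∃-outside S≢⊤ | complete (updateAt u j not)
... | here u′≡u = contradiction (subst (λ r → agreeOff S u r ≡ true) (sym u′≡u) (agreeOff-refl S u))
                                (agreeOff-updateAt-not j∉S u)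
... | there u′∈L =
  Any.map (λ u′≡r → subst (λ r → agreeOff S u r ≢ true) u′≡r (agreeOff-updateAt-not j∉S u)) u′∈L

lemma8 : (n : ℕ) (P : Rows n) → InCGn n P →
    (k : Fin (suc n)) (S : Subset (suc n)) →
    InChar S (weave1 k P) → S ≢ ⊤ → k ∉ S
lemma8 n [] ((_ , _ , complete) , _) k S _ _ _ with () ← complete (replicate n false)
lemma8 n (p ∷ P) _ k S (inj₁ refl) _ k∈S = ∉⊥ k∈S
lemma8 n (p ∷ P) _ k S (inj₂ (inj₁ S≡⊤)) S≢⊤ _ = S≢⊤ S≡⊤
lemma8 n (p ∷ P) ((_ , unique , complete) , gray) k S (inj₂ (inj₂ constant)) S≢⊤ k∈S =
  gray-subMatrix-not-constant S
    (insertCol-dup-gray k refl gray)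
    (weave1-head-∉ k unique)
    (agreeOff-insertAt k∈S p true false)
    (complete⇒disagreeing S≢⊤ (weave1-complete k complete))
    constant
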